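{- Let $p(z)=a_dz^d+\dots+a_0\in\mathbb{Z}[z]$ be a non-odd polynomial of degree $d\ge2$ with positive leading coefficient, and suppose $0<\frac1q\ll\frac1{\|p\|},\frac1d<1$. Let $t\in[d]$. Then there exist integers $h_{r,i}\in[-q,q]$, for $0\le i\le d-t$ and $t+i\le r\le d$, such that for all $s,k\in\mathbb{N}$, $$\sum_{j=1}^{t}(-1)^j\binom{t}{j}\,m_{js}(k)=\sum_{i=0}^{d-t}\sum_{r=t+i}^{d}h_{r,i}\,s^{r-i}k^i.$$ Moreover, $h_{d,d-t}\ne0$, and if $t\le d-1$ then also $h_{d,d-t-1}\neq0$.
   Context: $\|p\|=d+\sum_i|a_i|$; a polynomial is odd if it takes only odd values on $\mathbb{Z}$, non-odd otherwise. $m_s(k)=p(k+s)-p(k)$. (The left side is the inner product $\mathbf{m}^k\cdot\mathbf{b}^{t,s}$ where $\mathbf{m}^k=(m_1(k),m_2(k),\dots)$ and $\mathbf{b}^{t,s}$ is the vector whose $(js)$-th coordinate is $(-1)^j\binom tj$ for $j=1,\dots,t$ and all other coordinates are $0$.) The hypothesis $1/q\ll 1/\|p\|,1/d$ means $q$ is sufficiently large in terms of $\|p\|$ and $d$. -}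

module Defs where

open import Data.Nat as ℕ using (ℕ; zero; suc; _∸_)
open import Data.Nat.Combinatorics using (_C_)
open import Data.Integer as ℤ using (ℤ; +_; -_; ∣_∣)
open import Data.Integer.Divisibility using (_∣_)
open import Data.Fin using (Fin; toℕ; fromℕ)
open import Relation.Nullary using (¬_)

sumBelow : ℕ → (ℕ → ℤ) → ℤ
sumBelow zero    f = + 0
sumBelow (suc n) f = sumBelow n f ℤ.+ f n

-- Σ_{j = lo}^{hi} f j  (empty, i.e. 0, if hi < lo)
sumFromTo : ℕ → ℕ → (ℕ → ℤ) → ℤ
sumFromTo lo hi f = sumBelow (suc hi ∸ lo) (λ u → f (lo ℕ.+ u))

sumFinℕ : (n : ℕ) → (Fin n → ℕ) → ℕ
sumFinℕ zero    f = 0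
sumFinℕ (suc n) f = f Data.Fin.zero ℕ.+ sumFinℕ n (λ i → f (Data.Fin.suc i))

sumFinℤ : (n : ℕ) → (Fin n → ℤ) → ℤ
sumFinℤ zero    f = + 0
sumFinℤ (suc n) f = f Data.Fin.zero ℤ.+ sumFinℤ n (λ i → f (Data.Fin.suc i))

-- A polynomial p(z) = a_d z^d + ... + a_0 given by its coefficients a : Fin (suc d) → ℤ,
-- a i being the coefficient of z^(toℕ i).
eval : (d : ℕ) → (Fin (suc d) → ℤ) → ℤ → ℤ
eval d a z = sumFinℤ (suc d) (λ i → a i ℤ.* (z ℤ.^ toℕ i))

norm : (d : ℕ) → (Fin (suc d) → ℤ) → ℕ
norm d a = d ℕ.+ sumFinℕ (suc d) (λ i → ∣ a i ∣)

OddInt : ℤ → Set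
OddInt n = ¬ ((+ 2) ∣ n)

OddPoly : (d : ℕ) → (Fin (suc d) → ℤ) → Set
OddPoly d a = ∀ (z : ℤ) → OddInt (eval d a z)

m : (d : ℕ) → (Fin (suc d) → ℤ) → ℕ → ℕ → ℤ
m d a s k = eval d a (+ (k ℕ.+ s)) ℤ.- eval d a (+ k)

lhs : (d : ℕ) → (Fin (suc d) → ℤ) → ℕ → ℕ → ℕ → ℤ
lhs d a t s k = sumFromTo 1 t (λ j → ((- (+ 1)) ℤ.^ j) ℤ.* (+ (t C j)) ℤ.* m d a (j ℕ.* s) k)

rhs : ℕ → ℕ → (ℕ → ℕ → ℤ) → ℕ → ℕ → ℤ
rhs d t h s k = sumFromTo 0 (d ∸ t) (λ i → sumFromTo (t ℕ.+ i) d (λ r →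
                  h r i ℤ.* ((+ s) ℤ.^ (r ∸ i)) ℤ.* ((+ k) ℤ.^ i)))

-- Write c_j = (-1)^j C(t,j). Since Σ_{j ≤ t} c_j = 0, the left side is Σ_{j ≤ t} c_j p(k + js).
-- Expanding each p(k + js) binomially, the coefficient of s^(r-i) k^i is a_r C(r,i) e(r-i,t), where
-- e(l,t) = Σ_{j ≤ t} c_j j^l. The moments satisfy e(l,t+1) = -Σ_{u<l} C(l,u) e(u,t), hence
-- e(l,t) = 0 for l < t, e(t,t) = (-1)^t t! and e(t+1,t) ≠ 0. The first fact confines the non-zero
-- coefficients to r - i ≥ t, the range of the right side; the other two give h_{d,d-t} ≠ 0 and
-- h_{d,d-t-1} ≠ 0. Finally |h_{r,i}| ≤ ‖p‖ · max_{r,i,t ≤ d} C(r,i) |e(r-i,t)|, a bound in ‖p‖ and d.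
module Submission where

open import Defs
open import Data.Nat as ℕ using (ℕ; zero; suc; _∸_; _!)
import Data.Nat.Properties as ℕ
open import Data.Nat.Combinatorics using (_C_; nCn≡1; nC1≡n; nCk≡nC[n∸k]; nCk+nC[k+1]≡[n+1]C[k+1])
open import Data.Nat.Combinatorics.Specification using (k>n⇒nCk≡0)
open import Data.Integer using (ℤ; +_; -_; _<_) renaming (_≤_ to _≤ℤ_)
open import Data.Fin as Fin using (Fin; toℕ; fromℕ)
open import Data.Product using (Σ; _×_; _,_)
open import Data.Sum using (inj₁; inj₂)
open import Function using (_∘_)
open import Relation.Binary.PropositionalEquality
open import Relation.Nullary using (¬_)

[1+n]Cn≡1+n : ∀ n → suc n C n ≡ suc n
[1+n]Cn≡1+n n = begin
  suc n C n            ≡⟨ nCk≡nC[n∸k] (ℕ.n≤1+n n) ⟩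
  suc n C (suc n ∸ n)  ≡⟨ cong (suc n C_) (ℕ.m+n∸n≡m 1 n) ⟩
  suc n C 1            ≡⟨ nC1≡n (suc n) ⟩
  suc n                ∎
  where open ≡-Reasoning

nCk≢0 : ∀ {n k} → k ℕ.≤ n → n C k ≢ 0
nCk≢0 {n}     {zero}  _   ()
nCk≢0 {suc n} {suc k} k≤n nCk≡0 =
  nCk≢0 (ℕ.≤-pred k≤n) (ℕ.m+n≡0⇒m≡0 (n C k) (trans (nCk+nC[k+1]≡[n+1]C[k+1] n k) nCk≡0))

module Sums where
  open import Data.Integer using (_+_; _-_; _*_; _^_)
  import Data.Integer.Properties as ℤ
  open import Data.Integer.Tactic.RingSolver using (solve-∀)
  open import Algebra.Properties.CommutativeSemiring.Binomial ℤ.+-*-commutativeSemiring as Binomial using ()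
  import Algebra.Properties.Semiring.Exp ℤ.+-*-semiring as Exp
  import Algebra.Properties.CommutativeSemiring.Exp ℤ.+-*-commutativeSemiring as CExp
  import Algebra.Properties.Monoid.Mult ℤ.+-0-monoid as Mult
  import Algebra.Properties.Monoid.Sum ℤ.+-0-monoid as Sum
  open ≡-Reasoning

  sumBelow-cong-< : ∀ n {f g : ℕ → ℤ} → (∀ u → u ℕ.< n → f u ≡ g u) → sumBelow n f ≡ sumBelow n g
  sumBelow-cong-< zero    f≗g = refl
  sumBelow-cong-< (suc n) f≗g =
    cong₂ _+_ (sumBelow-cong-< n (λ u u<n → f≗g u (ℕ.m<n⇒m<1+n u<n))) (f≗g n ℕ.≤-refl)

  sumBelow-cong : ∀ n {f g : ℕ → ℤ} → (∀ u → f u ≡ g u) → sumBelow n f ≡ sumBelow n g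
  sumBelow-cong n f≗g = sumBelow-cong-< n (λ u _ → f≗g u)

  sumBelow-zero : ∀ n {f : ℕ → ℤ} → (∀ u → u ℕ.< n → f u ≡ + 0) → sumBelow n f ≡ + 0
  sumBelow-zero zero    f≡0 = refl
  sumBelow-zero (suc n) f≡0 =
    cong₂ _+_ (sumBelow-zero n (λ u u<n → f≡0 u (ℕ.m<n⇒m<1+n u<n))) (f≡0 n ℕ.≤-refl)

  sumBelow-+ : ∀ n (f g : ℕ → ℤ) → sumBelow n (λ u → f u + g u) ≡ sumBelow n f + sumBelow n g
  sumBelow-+ zero    f g = refl
  sumBelow-+ (suc n) f g = trans (cong (_+ (f n + g n)) (sumBelow-+ n f g)) (interchange (sumBelow n f) (sumBelow n g) (f n) (g n))
    where interchange : ∀ a b c d → (a + b) + (c + d) ≡ (a + c) + (b + d)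
          interchange = solve-∀

  sumBelow-sub : ∀ n (f g : ℕ → ℤ) → sumBelow n (λ u → f u - g u) ≡ sumBelow n f - sumBelow n g
  sumBelow-sub zero    f g = refl
  sumBelow-sub (suc n) f g = trans (cong (_+ (f n - g n)) (sumBelow-sub n f g)) (interchange (sumBelow n f) (sumBelow n g) (f n) (g n))
    where interchange : ∀ a b c d → (a - b) + (c - d) ≡ (a + c) - (b + d)
          interchange = solve-∀

  sumBelow-*ˡ : ∀ n c (f : ℕ → ℤ) → c * sumBelow n f ≡ sumBelow n (λ u → c * f u)
  sumBelow-*ˡ zero    c f = ℤ.*-zeroʳ c
  sumBelow-*ˡ (suc n) c f = trans (ℤ.*-distribˡ-+ c (sumBelow n f) (f n)) (cong (_+ c * f n) (sumBelow-*ˡ n c f))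

  sumBelow-*ʳ : ∀ n c (f : ℕ → ℤ) → sumBelow n f * c ≡ sumBelow n (λ u → f u * c)
  sumBelow-*ʳ zero    c f = ℤ.*-zeroˡ c
  sumBelow-*ʳ (suc n) c f = trans (ℤ.*-distribʳ-+ c (sumBelow n f) (f n)) (cong (_+ f n * c) (sumBelow-*ʳ n c f))

  sumBelow-swap : ∀ m n (f : ℕ → ℕ → ℤ) →
    sumBelow m (λ x → sumBelow n (f x)) ≡ sumBelow n (λ y → sumBelow m (λ x → f x y))
  sumBelow-swap zero    n f = sym (sumBelow-zero n (λ _ _ → refl))
  sumBelow-swap (suc m) n f = trans (cong (_+ sumBelow n (f m)) (sumBelow-swap m n f))
                                    (sym (sumBelow-+ n (λ y → sumBelow m (λ x → f x y)) (f m)))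

  sumBelow-head : ∀ n (f : ℕ → ℤ) → sumBelow (suc n) f ≡ f 0 + sumBelow n (f ∘ suc)
  sumBelow-head zero    f = ℤ.+-comm (+ 0) (f 0)
  sumBelow-head (suc n) f = trans (cong (_+ f (suc n)) (sumBelow-head n f))
                                  (ℤ.+-assoc (f 0) (sumBelow n (f ∘ suc)) (f (suc n)))

  sumBelow-truncate : ∀ {m n} (f : ℕ → ℤ) → m ℕ.≤ n → (∀ u → m ℕ.≤ u → u ℕ.< n → f u ≡ + 0) →
                      sumBelow n f ≡ sumBelow m f
  sumBelow-truncate {m} {n} f m≤n f≡0 = begin
    sumBelow n f                  ≡⟨ cong (λ n → sumBelow n f) (sym (ℕ.m∸n+n≡m m≤n)) ⟩
    sumBelow ((n ∸ m) ℕ.+ m) f    ≡⟨ dropTop (n ∸ m) (λ u u<n∸m →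
                                       f≡0 (u ℕ.+ m) (ℕ.m≤n+m m u) (ℕ.m≤o∸n⇒m+n≤o (suc u) m≤n u<n∸m)) ⟩
    sumBelow m f                  ∎
    where
    dropTop : ∀ k → (∀ u → u ℕ.< k → f (u ℕ.+ m) ≡ + 0) → sumBelow (k ℕ.+ m) f ≡ sumBelow m f
    dropTop zero    _   = refl
    dropTop (suc k) f≡0 = trans (cong₂ _+_ (dropTop k (λ u u<k → f≡0 u (ℕ.m<n⇒m<1+n u<k))) (f≡0 k ℕ.≤-refl))
                                (ℤ.+-identityʳ (sumBelow m f))

  sumBelow-shift : ∀ lo n (f : ℕ → ℤ) → (∀ u → u ℕ.< lo → f u ≡ + 0) →
                   sumBelow n f ≡ sumBelow (n ∸ lo) (λ u → f (lo ℕ.+ u))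
  sumBelow-shift zero     n       f _   = refl
  sumBelow-shift (suc lo) zero    f _   = refl
  sumBelow-shift (suc lo) (suc n) f f≡0 = begin
    sumBelow (suc n) f                                 ≡⟨ sumBelow-head n f ⟩
    f 0 + sumBelow n (f ∘ suc)                         ≡⟨ cong₂ _+_ (f≡0 0 (ℕ.s≤s ℕ.z≤n))
                                                            (sumBelow-shift lo n (f ∘ suc) (λ u → f≡0 (suc u) ∘ ℕ.s≤s)) ⟩
    + 0 + sumBelow (n ∸ lo) (λ u → f (suc lo ℕ.+ u))   ≡⟨ ℤ.+-identityˡ _ ⟩
    sumBelow (n ∸ lo) (λ u → f (suc lo ℕ.+ u))         ∎

  sumFinℤ≡sumBelow : ∀ n (g : Fin n → ℤ) (f : ℕ → ℤ) → (∀ i → g i ≡ f (toℕ i)) →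
                     sumFinℤ n g ≡ sumBelow n f
  sumFinℤ≡sumBelow zero    g f _   = refl
  sumFinℤ≡sumBelow (suc n) g f g≗f =
    trans (cong₂ _+_ (g≗f Fin.zero) (sumFinℤ≡sumBelow n (g ∘ Fin.suc) (f ∘ suc) (g≗f ∘ Fin.suc)))
          (sym (sumBelow-head n f))

  Exp^≡^ : ∀ z n → z Exp.^ n ≡ z ^ n
  Exp^≡^ z zero    = refl
  Exp^≡^ z (suc n) = cong (z *_) (Exp^≡^ z n)

  ^-distrib-* : ∀ x y n → (x * y) ^ n ≡ x ^ n * y ^ n
  ^-distrib-* x y n = trans (sym (Exp^≡^ (x * y) n)) (trans (CExp.^-distrib-* x y n) (cong₂ _*_ (Exp^≡^ x n) (Exp^≡^ y n)))

  binomial : ∀ x y r → (x + y) ^ r ≡ sumBelow (suc r) (λ i → + (r C i) * (x ^ i * y ^ (r ∸ i)))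
  binomial x y r = begin
    (x + y) ^ r                        ≡⟨ sym (Exp^≡^ (x + y) r) ⟩
    (x + y) Exp.^ r                    ≡⟨ Binomial.theorem r x y ⟩
    Binomial.binomialExpansion x y r   ≡⟨ Sum≡sumFinℤ (suc r) (Binomial.binomialTerm x y r) ⟩
    sumFinℤ (suc r) (Binomial.binomialTerm x y r) ≡⟨ sumFinℤ≡sumBelow (suc r) _ _ term ⟩
    sumBelow (suc r) (λ i → + (r C i) * (x ^ i * y ^ (r ∸ i))) ∎
    where
    ×≡* : ∀ n z → n Mult.× z ≡ + n * z
    ×≡* zero    z = sym (ℤ.*-zeroˡ z)
    ×≡* (suc n) z = begin
      z + n Mult.× z     ≡⟨ cong (λ w → z + w) (×≡* n z) ⟩
      z + + n * z        ≡⟨ cong (_+ + n * z) (sym (ℤ.*-identityˡ z)) ⟩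
      + 1 * z + + n * z  ≡⟨ sym (ℤ.*-distribʳ-+ z (+ 1) (+ n)) ⟩
      + suc n * z        ∎

    Sum≡sumFinℤ : ∀ n (g : Fin n → ℤ) → Sum.sum g ≡ sumFinℤ n g
    Sum≡sumFinℤ zero    g = refl
    Sum≡sumFinℤ (suc n) g = cong (λ w → g Fin.zero + w) (Sum≡sumFinℤ n (g ∘ Fin.suc))

    term : ∀ k → Binomial.binomialTerm x y r k ≡ + (r C toℕ k) * (x ^ toℕ k * y ^ (r ∸ toℕ k))
    term k = trans (×≡* (r C toℕ k) _)
                   (cong (+ (r C toℕ k) *_) (cong₂ _*_ (Exp^≡^ x (toℕ k)) (Exp^≡^ y (r ∸ toℕ k))))

module Moments where
  open import Data.Integer using (_+_; _-_; _*_; _^_)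
  import Data.Integer.Properties as ℤ
  open import Data.Integer.Tactic.RingSolver using (solve-∀)
  open import Algebra.Properties.CommutativeSemigroup ℤ.*-commutativeSemigroup using (x∙yz≈y∙xz)
  open Sums
  open ≡-Reasoning

  *-distribˡ-sub : ∀ c x y → c * (x - y) ≡ c * x - c * y
  *-distribˡ-sub = solve-∀

  *-distribʳ-sub : ∀ x a b → (a - b) * x ≡ a * x - b * x
  *-distribʳ-sub = solve-∀

  sign : ℕ → ℤ
  sign j = (- (+ 1)) ^ j

  alternatingBinomial : ℕ → ℕ → ℤ
  alternatingBinomial t j = sign j * + (t C j)

  -- (-1)^t t! S(l,t), with S(l,t) a Stirling number of the second kind.
  moment : ℕ → ℕ → ℤ
  moment l t = sumBelow (suc t) (λ j → alternatingBinomial t j * (+ j) ^ l)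

  alternatingBinomial-suc : ∀ t j →
    alternatingBinomial (suc t) (suc j) ≡ alternatingBinomial t (suc j) - alternatingBinomial t j
  alternatingBinomial-suc t j = begin
    - (+ 1) * sign j * + (suc t C suc j)
      ≡⟨ cong (λ c → - (+ 1) * sign j * + c) (sym (nCk+nC[k+1]≡[n+1]C[k+1] t j)) ⟩
    - (+ 1) * sign j * + ((t C j) ℕ.+ (t C suc j))
      ≡⟨ cong (- (+ 1) * sign j *_) (ℤ.pos-+ (t C j) (t C suc j)) ⟩
    - (+ 1) * sign j * (+ (t C j) + + (t C suc j))
      ≡⟨ pascal (sign j) (+ (t C j)) (+ (t C suc j)) ⟩
    - (+ 1) * sign j * + (t C suc j) - sign j * + (t C j) ∎
    where pascal : ∀ σ a b → - (+ 1) * σ * (a + b) ≡ - (+ 1) * σ * b - σ * a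
          pascal = solve-∀

  alternatingBinomial-top : ∀ t → alternatingBinomial t (suc t) ≡ + 0
  alternatingBinomial-top t =
    trans (cong (λ c → sign (suc t) * + c) (k>n⇒nCk≡0 {t} {suc t} ℕ.≤-refl)) (ℤ.*-zeroʳ (sign (suc t)))

  -- Σ_{j ≤ t} (-1)^j C(t,j) g j = (-1)^t (Δ^t g) 0 for the forward difference Δ, so this is Δ^{t+1} = Δ^t ∘ Δ.
  alternatingSum-suc : ∀ t (g : ℕ → ℤ) →
    sumBelow (suc (suc t)) (λ j → alternatingBinomial (suc t) j * g j) ≡
    sumBelow (suc t) (λ j → alternatingBinomial t j * (g j - g (suc j)))
  alternatingSum-suc t g = begin
    sumBelow (suc (suc t)) (λ j → alternatingBinomial (suc t) j * g j)
      ≡⟨ sumBelow-head (suc t) _ ⟩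
    c₀ + sumBelow (suc t) (λ j → alternatingBinomial (suc t) (suc j) * g (suc j))
      ≡⟨ cong (λ x → c₀ + x) (sumBelow-cong (suc t) (λ j →
           trans (cong (_* g (suc j)) (alternatingBinomial-suc t j))
                 (*-distribʳ-sub (g (suc j)) (alternatingBinomial t (suc j)) (alternatingBinomial t j)))) ⟩
    c₀ + sumBelow (suc t) (λ j → alternatingBinomial t (suc j) * g (suc j) - alternatingBinomial t j * g (suc j))
      ≡⟨ cong (λ x → c₀ + x) (sumBelow-sub (suc t) _ _) ⟩
    c₀ + ((A + alternatingBinomial t (suc t) * g (suc t)) - B)
      ≡⟨ cong (λ c → c₀ + ((A + c * g (suc t)) - B)) (alternatingBinomial-top t) ⟩
    c₀ + ((A + + 0 * g (suc t)) - B)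
      ≡⟨ regroup c₀ A B (g (suc t)) ⟩
    (c₀ + A) - B
      ≡⟨ cong (_- B) (sym (sumBelow-head t (λ j → alternatingBinomial t j * g j))) ⟩
    sumBelow (suc t) (λ j → alternatingBinomial t j * g j) - B
      ≡⟨ sym (trans (sumBelow-cong (suc t) (λ j → *-distribˡ-sub (alternatingBinomial t j) (g j) (g (suc j))))
                    (sumBelow-sub (suc t) _ _)) ⟩
    sumBelow (suc t) (λ j → alternatingBinomial t j * (g j - g (suc j))) ∎
    where
    c₀ = alternatingBinomial t 0 * g 0
    A = sumBelow t (λ j → alternatingBinomial t (suc j) * g (suc j))
    B = sumBelow (suc t) (λ j → alternatingBinomial t j * g (suc j))
    regroup : ∀ c a b x → c + ((a + + 0 * x) - b) ≡ (c + a) - b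
    regroup = solve-∀

  binomial-+1 : ∀ x l → (x + + 1) ^ l ≡ sumBelow l (λ u → + (l C u) * x ^ u) + x ^ l
  binomial-+1 x l = begin
    (x + + 1) ^ l                                                  ≡⟨ binomial x (+ 1) l ⟩
    sumBelow (suc l) (λ u → + (l C u) * (x ^ u * (+ 1) ^ (l ∸ u)))   ≡⟨ sumBelow-cong (suc l) drop1 ⟩
    S + + (l C l) * x ^ l                                          ≡⟨ cong (λ c → S + + c * x ^ l) (nCn≡1 l) ⟩
    S + + 1 * x ^ l                                                ≡⟨ cong (λ y → S + y) (ℤ.*-identityˡ (x ^ l)) ⟩
    S + x ^ l                                                      ∎
    where
    S = sumBelow l (λ u → + (l C u) * x ^ u)
    drop1 : ∀ u → + (l C u) * (x ^ u * (+ 1) ^ (l ∸ u)) ≡ + (l C u) * x ^ u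
    drop1 u = trans (cong (λ y → + (l C u) * (x ^ u * y)) (ℤ.^-zeroˡ (l ∸ u)))
                    (cong (λ y → + (l C u) * y) (ℤ.*-identityʳ (x ^ u)))

  moment-suc : ∀ l t → moment l (suc t) ≡ - sumBelow l (λ u → + (l C u) * moment u t)
  moment-suc l t = begin
    moment l (suc t)
      ≡⟨ alternatingSum-suc t (λ j → (+ j) ^ l) ⟩
    sumBelow (suc t) (λ j → alternatingBinomial t j * ((+ j) ^ l - (+ suc j) ^ l))
      ≡⟨ sumBelow-cong (suc t) difference ⟩
    sumBelow (suc t) (λ j → - (+ 1) * sumBelow l (λ u → alternatingBinomial t j * (+ (l C u) * (+ j) ^ u)))
      ≡⟨ sym (sumBelow-*ˡ (suc t) (- (+ 1)) _) ⟩
    - (+ 1) * sumBelow (suc t) (λ j → sumBelow l (λ u → alternatingBinomial t j * (+ (l C u) * (+ j) ^ u)))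
      ≡⟨ cong (- (+ 1) *_) (sumBelow-swap (suc t) l _) ⟩
    - (+ 1) * sumBelow l (λ u → sumBelow (suc t) (λ j → alternatingBinomial t j * (+ (l C u) * (+ j) ^ u)))
      ≡⟨ cong (- (+ 1) *_) (sumBelow-cong l factor) ⟩
    - (+ 1) * sumBelow l (λ u → + (l C u) * moment u t)
      ≡⟨ ℤ.-1*i≡-i _ ⟩
    - sumBelow l (λ u → + (l C u) * moment u t) ∎
    where
    difference : ∀ j → alternatingBinomial t j * ((+ j) ^ l - (+ suc j) ^ l)
                     ≡ - (+ 1) * sumBelow l (λ u → alternatingBinomial t j * (+ (l C u) * (+ j) ^ u))
    difference j = begin
      c * ((+ j) ^ l - (+ suc j) ^ l)       ≡⟨ cong (λ y → c * ((+ j) ^ l - y ^ l)) (ℤ.+-comm (+ 1) (+ j)) ⟩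
      c * ((+ j) ^ l - (+ j + + 1) ^ l)     ≡⟨ cong (λ y → c * ((+ j) ^ l - y)) (binomial-+1 (+ j) l) ⟩
      c * ((+ j) ^ l - (S + (+ j) ^ l))     ≡⟨ cancel c S ((+ j) ^ l) ⟩
      - (+ 1) * (c * S)                     ≡⟨ cong (- (+ 1) *_) (sumBelow-*ˡ l c _) ⟩
      - (+ 1) * sumBelow l (λ u → c * (+ (l C u) * (+ j) ^ u)) ∎
      where
      c = alternatingBinomial t j
      S = sumBelow l (λ u → + (l C u) * (+ j) ^ u)
      cancel : ∀ c s x → c * (x - (s + x)) ≡ - (+ 1) * (c * s)
      cancel = solve-∀
    factor : ∀ u → sumBelow (suc t) (λ j → alternatingBinomial t j * (+ (l C u) * (+ j) ^ u)) ≡ + (l C u) * moment u t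
    factor u = trans (sumBelow-cong (suc t) (λ j → x∙yz≈y∙xz (alternatingBinomial t j) (+ (l C u)) ((+ j) ^ u)))
                     (sym (sumBelow-*ˡ (suc t) (+ (l C u)) _))

  *-≢0 : ∀ {x y} → x ≢ + 0 → y ≢ + 0 → x * y ≢ + 0
  *-≢0 {x} x≢0 y≢0 xy≡0 with ℤ.i*j≡0⇒i≡0∨j≡0 x xy≡0
  ... | inj₁ x≡0 = x≢0 x≡0
  ... | inj₂ y≡0 = y≢0 y≡0

  sign≢0 : ∀ j → sign j ≢ + 0
  sign≢0 j σ≡0 with ℤ.i^n≡0⇒i≡0 (- (+ 1)) j σ≡0
  ... | ()

  +≢0 : ∀ {n} → n ≢ 0 → + n ≢ + 0
  +≢0 n≢0 = n≢0 ∘ ℤ.+-injective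

  moment-vanishes : ∀ {l t} → l ℕ.< t → moment l t ≡ + 0
  moment-vanishes {l} {suc t} l<t = trans (moment-suc l t) (cong -_ (sumBelow-zero l term≡0))
    where
    term≡0 : ∀ u → u ℕ.< l → + (l C u) * moment u t ≡ + 0
    term≡0 u u<l = trans (cong (+ (l C u) *_) (moment-vanishes (ℕ.<-≤-trans u<l (ℕ.≤-pred l<t)))) (ℤ.*-zeroʳ (+ (l C u)))

  lowerMoments-vanish : ∀ l t → sumBelow t (λ u → + (l C u) * moment u t) ≡ + 0
  lowerMoments-vanish l t = sumBelow-zero t (λ u u<t → trans (cong (+ (l C u) *_) (moment-vanishes u<t)) (ℤ.*-zeroʳ (+ (l C u))))

  moment-diagonal : ∀ t → moment t t ≡ sign t * + (t !)
  moment-diagonal zero    = refl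
  moment-diagonal (suc t) = begin
    moment (suc t) (suc t)                                            ≡⟨ moment-suc (suc t) t ⟩
    - (sumBelow t lower + + (suc t C t) * moment t t)                 ≡⟨ cong₂ (λ z c → - (z + + c * moment t t))
                                                                           (lowerMoments-vanish (suc t) t) ([1+n]Cn≡1+n t) ⟩
    - (+ 0 + + suc t * moment t t)                                    ≡⟨ cong (λ e → - (+ 0 + + suc t * e)) (moment-diagonal t) ⟩
    - (+ 0 + + suc t * (sign t * + (t !)))                            ≡⟨ rearrange (+ suc t) (sign t) (+ (t !)) ⟩
    sign (suc t) * (+ suc t * + (t !))                                ≡⟨ cong (sign (suc t) *_) (sym (ℤ.pos-* (suc t) (t !))) ⟩
    sign (suc t) * + (suc t !)                                        ∎
    where
    lower = λ u → + (suc t C u) * moment u t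
    rearrange : ∀ n σ f → - (+ 0 + n * (σ * f)) ≡ - (+ 1) * σ * (n * f)
    rearrange = solve-∀

  moment-diagonal≢0 : ∀ t → moment t t ≢ + 0
  moment-diagonal≢0 t = subst (_≢ + 0) (sym (moment-diagonal t)) (*-≢0 (sign≢0 t) (+≢0 (ℕ.>⇒≢ (ℕ.1≤n! t))))

  -- Equal to t! · C(t+1,2); only its positivity is used.
  subdiagonal : ℕ → ℕ
  subdiagonal zero    = 0
  subdiagonal (suc t) = (suc (suc t) C t) ℕ.* t ! ℕ.+ suc (suc t) ℕ.* subdiagonal t

  moment-subdiagonal : ∀ t → moment (suc t) t ≡ sign t * + subdiagonal t
  moment-subdiagonal zero    = refl
  moment-subdiagonal (suc t) = begin
    moment (suc (suc t)) (suc t)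
      ≡⟨ moment-suc (suc (suc t)) t ⟩
    - ((sumBelow t lower + + a * moment t t) + + (suc (suc t) C suc t) * moment (suc t) t)
      ≡⟨ cong₂ (λ z c → - ((z + + a * moment t t) + + c * moment (suc t) t))
               (lowerMoments-vanish (suc (suc t)) t) ([1+n]Cn≡1+n (suc t)) ⟩
    - ((+ 0 + + a * moment t t) + + suc (suc t) * moment (suc t) t)
      ≡⟨ cong₂ (λ e f → - ((+ 0 + + a * e) + + suc (suc t) * f)) (moment-diagonal t) (moment-subdiagonal t) ⟩
    - ((+ 0 + + a * (sign t * + (t !))) + + suc (suc t) * (sign t * + subdiagonal t))
      ≡⟨ rearrange (+ a) (sign t) (+ (t !)) (+ suc (suc t)) (+ subdiagonal t) ⟩
    sign (suc t) * (+ a * + (t !) + + suc (suc t) * + subdiagonal t)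
      ≡⟨ cong (sign (suc t) *_) (sym (trans (ℤ.pos-+ (a ℕ.* t !) _)
                                           (cong₂ _+_ (ℤ.pos-* a (t !)) (ℤ.pos-* (suc (suc t)) (subdiagonal t))))) ⟩
    sign (suc t) * + subdiagonal (suc t) ∎
    where
    a = suc (suc t) C t
    lower = λ u → + (suc (suc t) C u) * moment u t
    rearrange : ∀ a σ f b x → - ((+ 0 + a * (σ * f)) + b * (σ * x)) ≡ - (+ 1) * σ * (a * f + b * x)
    rearrange = solve-∀

  moment-subdiagonal≢0 : ∀ {t} → 1 ℕ.≤ t → moment (suc t) t ≢ + 0
  moment-subdiagonal≢0 {suc t} _ =
    subst (_≢ + 0) (sym (moment-subdiagonal (suc t))) (*-≢0 (sign≢0 (suc t)) (+≢0 subdiagonal≢0))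
    where
    subdiagonal≢0 : subdiagonal (suc t) ≢ 0
    subdiagonal≢0 subdiagonal≡0 with ℕ.m*n≡0⇒m≡0∨n≡0 (suc (suc t) C t) (ℕ.m+n≡0⇒m≡0 _ subdiagonal≡0)
    ... | inj₁ C≡0  = nCk≢0 (ℕ.m≤n⇒m≤1+n (ℕ.n≤1+n t)) C≡0
    ... | inj₂ t!≡0 = ℕ.>⇒≢ (ℕ.1≤n! t) t!≡0

  alternatingSum-differences : ∀ {t} → 1 ℕ.≤ t → (g : ℕ → ℤ) →
    sumFromTo 1 t (λ j → alternatingBinomial t j * (g j - g 0)) ≡ sumBelow (suc t) (λ j → alternatingBinomial t j * g j)
  alternatingSum-differences {t} 1≤t g = begin
    sumBelow t (λ u → alternatingBinomial t (suc u) * (g (suc u) - g 0))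
      ≡⟨ trans (sumBelow-cong t (λ u → *-distribˡ-sub (alternatingBinomial t (suc u)) (g (suc u)) (g 0))) (sumBelow-sub t _ _) ⟩
    A - sumBelow t (λ u → alternatingBinomial t (suc u) * g 0)
      ≡⟨ cong (λ z → A - z) (sym (sumBelow-*ʳ t (g 0) (alternatingBinomial t ∘ suc))) ⟩
    A - T * g 0
      ≡⟨ absorb A T c₀ (g 0) c₀+T≡0 ⟩
    c₀ * g 0 + A
      ≡⟨ sym (sumBelow-head t (λ j → alternatingBinomial t j * g j)) ⟩
    sumBelow (suc t) (λ j → alternatingBinomial t j * g j) ∎
    where
    A = sumBelow t (λ u → alternatingBinomial t (suc u) * g (suc u))
    T = sumBelow t (alternatingBinomial t ∘ suc)
    c₀ = alternatingBinomial t 0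
    c₀+T≡0 : c₀ + T ≡ + 0
    c₀+T≡0 = begin
      c₀ + T                                                        ≡⟨ sym (sumBelow-head t (alternatingBinomial t)) ⟩
      sumBelow (suc t) (alternatingBinomial t)                      ≡⟨ sumBelow-cong (suc t) (λ j → sym (ℤ.*-identityʳ _)) ⟩
      moment 0 t                                                    ≡⟨ moment-vanishes 1≤t ⟩
      + 0                                                           ∎
    absorb : ∀ a τ c x → c + τ ≡ + 0 → a - τ * x ≡ c * x + a
    absorb a τ c x c+τ≡0 = trans (shuffle a τ c x) (trans (cong (λ z → c * x + a - z * x) c+τ≡0) (dropZero (c * x + a) x))
      where shuffle : ∀ a τ c x → a - τ * x ≡ c * x + a - (c + τ) * x
            shuffle = solve-∀
            dropZero : ∀ y x → y - + 0 * x ≡ y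
            dropZero = solve-∀

module Expansion where
  open import Data.Integer using (_+_; _-_; _*_; _^_; ∣_∣)
  import Data.Integer.Properties as ℤ
  open import Data.Integer.Tactic.RingSolver using (solve-∀)
  open Sums
  open Moments
  open ≡-Reasoning

  coefficient : ∀ {n} → (Fin n → ℤ) → ℕ → ℤ
  coefficient {zero}  a _       = + 0
  coefficient {suc n} a zero    = a Fin.zero
  coefficient {suc n} a (suc r) = coefficient (a ∘ Fin.suc) r

  coefficient-toℕ : ∀ {n} (a : Fin n → ℤ) i → a i ≡ coefficient a (toℕ i)
  coefficient-toℕ a Fin.zero    = refl
  coefficient-toℕ a (Fin.suc i) = coefficient-toℕ (a ∘ Fin.suc) i

  coefficient-fromℕ : ∀ d (a : Fin (suc d) → ℤ) → coefficient a d ≡ a (fromℕ d)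
  coefficient-fromℕ zero    a = refl
  coefficient-fromℕ (suc d) a = coefficient-fromℕ d (a ∘ Fin.suc)

  ∣coefficient∣≤ : ∀ {n} (a : Fin n → ℤ) r → ∣ coefficient a r ∣ ℕ.≤ sumFinℕ n (λ i → ∣ a i ∣)
  ∣coefficient∣≤ {zero}  a r       = ℕ.z≤n
  ∣coefficient∣≤ {suc n} a zero    = ℕ.m≤m+n _ _
  ∣coefficient∣≤ {suc n} a (suc r) = ℕ.≤-trans (∣coefficient∣≤ (a ∘ Fin.suc) r) (ℕ.m≤n+m _ _)

  eval≡sumBelow : ∀ d a z → eval d a z ≡ sumBelow (suc d) (λ r → coefficient a r * z ^ r)
  eval≡sumBelow d a z = sumFinℤ≡sumBelow (suc d) _ _ (λ i → cong (_* z ^ toℕ i) (coefficient-toℕ a i))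

  differenceCoefficient : (d : ℕ) → (Fin (suc d) → ℤ) → ℕ → ℕ → ℕ → ℤ
  differenceCoefficient d a t r i = coefficient a r * + (r C i) * moment (r ∸ i) t

  module _ (d : ℕ) (a : Fin (suc d) → ℤ) (t s k : ℕ) where

    term : ℕ → ℕ → ℤ
    term r i = differenceCoefficient d a t r i * (+ s) ^ (r ∸ i) * (+ k) ^ i

    -- + k comes last so that point 0 reduces to + k.
    point : ℕ → ℤ
    point j = + j * + s + + k

    alternatingSum-eval : sumBelow (suc t) (λ j → alternatingBinomial t j * eval d a (point j)) ≡
                          sumBelow (suc d) (λ r → sumBelow (suc r) (term r))
    alternatingSum-eval = begin
      sumBelow (suc t) (λ j → alternatingBinomial t j * eval d a (point j))
        ≡⟨ sumBelow-cong (suc t) (λ j → cong (alternatingBinomial t j *_) (expand j)) ⟩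
      sumBelow (suc t) (λ j → alternatingBinomial t j * sumBelow (suc d) (λ r → sumBelow (suc r) (summand j r)))
        ≡⟨ sumBelow-cong (suc t) (λ j →
             trans (sumBelow-*ˡ (suc d) (alternatingBinomial t j) _)
                   (sumBelow-cong (suc d) (λ r → sumBelow-*ˡ (suc r) (alternatingBinomial t j) (summand j r)))) ⟩
      sumBelow (suc t) (λ j → sumBelow (suc d) (λ r → sumBelow (suc r) (λ i → alternatingBinomial t j * summand j r i)))
        ≡⟨ sumBelow-swap (suc t) (suc d) _ ⟩
      sumBelow (suc d) (λ r → sumBelow (suc t) (λ j → sumBelow (suc r) (λ i → alternatingBinomial t j * summand j r i)))
        ≡⟨ sumBelow-cong (suc d) (λ r → trans (sumBelow-swap (suc t) (suc r) _) (sumBelow-cong (suc r) (collect r))) ⟩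
      sumBelow (suc d) (λ r → sumBelow (suc r) (term r)) ∎
      where
      summand : ℕ → ℕ → ℕ → ℤ
      summand j r i = coefficient a r * (+ (r C i) * ((+ k) ^ i * (+ j * + s) ^ (r ∸ i)))

      expand : ∀ j → eval d a (point j) ≡ sumBelow (suc d) (λ r → sumBelow (suc r) (summand j r))
      expand j = trans (eval≡sumBelow d a (point j)) (sumBelow-cong (suc d) (λ r →
        trans (cong (λ z → coefficient a r * z ^ r) (ℤ.+-comm (+ j * + s) (+ k)))
              (trans (cong (coefficient a r *_) (binomial (+ k) (+ j * + s) r)) (sumBelow-*ˡ (suc r) (coefficient a r) _))))

      collect : ∀ r i → sumBelow (suc t) (λ j → alternatingBinomial t j * summand j r i) ≡ term r i
      collect r i = begin
        sumBelow (suc t) (λ j → alternatingBinomial t j * summand j r i)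
          ≡⟨ sumBelow-cong (suc t) (λ j →
               trans (cong (λ p → alternatingBinomial t j * (A * (Cri * (K * p)))) (^-distrib-* (+ j) (+ s) n))
                     (regroup (alternatingBinomial t j) A Cri K ((+ j) ^ n) S)) ⟩
        sumBelow (suc t) (λ j → alternatingBinomial t j * (+ j) ^ n * (A * Cri * S * K))
          ≡⟨ sym (sumBelow-*ʳ (suc t) (A * Cri * S * K) _) ⟩
        moment n t * (A * Cri * S * K)
          ≡⟨ regroup′ (moment n t) A Cri S K ⟩
        term r i ∎
        where
        n = r ∸ i
        A = coefficient a r
        Cri = + (r C i)
        K = (+ k) ^ i
        S = (+ s) ^ n
        regroup : ∀ c A C K J S → c * (A * (C * (K * (J * S)))) ≡ c * J * (A * C * S * K)
        regroup = solve-∀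
        regroup′ : ∀ e A C S K → e * (A * C * S * K) ≡ A * C * e * S * K
        regroup′ = solve-∀

    term-vanishes : ∀ {r i} → r ∸ i ℕ.< t → term r i ≡ + 0
    term-vanishes {r} {i} r∸i<t = begin
      coefficient a r * + (r C i) * moment (r ∸ i) t * (+ s) ^ (r ∸ i) * (+ k) ^ i
        ≡⟨ cong (λ e → coefficient a r * + (r C i) * e * (+ s) ^ (r ∸ i) * (+ k) ^ i) (moment-vanishes r∸i<t) ⟩
      coefficient a r * + (r C i) * + 0 * (+ s) ^ (r ∸ i) * (+ k) ^ i
        ≡⟨ annihilate (coefficient a r) (+ (r C i)) ((+ s) ^ (r ∸ i)) ((+ k) ^ i) ⟩
      + 0 ∎
      where annihilate : ∀ A C S K → A * C * + 0 * S * K ≡ + 0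
            annihilate = solve-∀

    -- term r i vanishes unless t ≤ r ∸ i, which cuts the triangle i ≤ r ≤ d down to the range of rhs.
    sumTriangle≡rhs : 1 ℕ.≤ t → t ℕ.≤ d →
      sumBelow (suc d) (λ r → sumBelow (suc r) (term r)) ≡ rhs d t (differenceCoefficient d a t) s k
    sumTriangle≡rhs 1≤t t≤d = begin
      sumBelow (suc d) (λ r → sumBelow (suc r) (term r))
        ≡⟨ sumBelow-cong-< (suc d) (λ r r<d →
             sym (sumBelow-truncate (term r) r<d (λ i r<i _ → term-vanishes {r} {i} (beyondDiagonal {r} {i} r<i)))) ⟩
      sumBelow (suc d) (λ r → sumBelow (suc d) (term r))
        ≡⟨ sumBelow-swap (suc d) (suc d) term ⟩
      sumBelow (suc d) (λ i → sumBelow (suc d) (λ r → term r i))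
        ≡⟨ sumBelow-cong (suc d) (λ i → sumBelow-shift (t ℕ.+ i) (suc d) (λ r → term r i)
                                          (λ r r<t+i → term-vanishes {r} {i} (belowBand {r} {i} r<t+i))) ⟩
      sumBelow (suc d) (λ i → sumFromTo (t ℕ.+ i) d (λ r → term r i))
        ≡⟨ sumBelow-truncate _ (ℕ.s≤s (ℕ.m∸n≤m d t)) (λ i d∸t<i _ → emptyRange d∸t<i) ⟩
      rhs d t (differenceCoefficient d a t) s k ∎
      where
      beyondDiagonal : ∀ {r i} → suc r ℕ.≤ i → r ∸ i ℕ.< t
      beyondDiagonal {r} {i} r<i = subst (ℕ._< t) (sym (ℕ.m≤n⇒m∸n≡0 (ℕ.<⇒≤ r<i))) 1≤t
      belowBand : ∀ {r i} → r ℕ.< t ℕ.+ i → r ∸ i ℕ.< t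
      belowBand {r} {i} r<t+i = ℕ.m<n+o⇒m∸n<o r i {{ℕ.>-nonZero 1≤t}} (subst (r ℕ.<_) (ℕ.+-comm t i) r<t+i)
      emptyRange : ∀ {i} → suc (d ∸ t) ℕ.≤ i → sumFromTo (t ℕ.+ i) d (λ r → term r i) ≡ + 0
      emptyRange {i} d∸t<i = cong (λ n → sumBelow n (λ u → term (t ℕ.+ i ℕ.+ u) i)) (ℕ.m≤n⇒m∸n≡0 1+d≤t+i)
        where
        1+d≤t+i : suc d ℕ.≤ t ℕ.+ i
        1+d≤t+i = subst (ℕ._≤ t ℕ.+ i) (trans (ℕ.+-suc t (d ∸ t)) (cong suc (ℕ.m+[n∸m]≡n t≤d)))
                        (ℕ.+-monoʳ-≤ t d∸t<i)

    lhs≡rhs : 1 ℕ.≤ t → t ℕ.≤ d → lhs d a t s k ≡ rhs d t (differenceCoefficient d a t) s k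
    lhs≡rhs 1≤t t≤d = begin
      lhs d a t s k
        ≡⟨ sumBelow-cong t (λ u → cong (λ z → alternatingBinomial t (suc u) * (eval d a z - eval d a (+ k)))
                                        (+≡point (suc u))) ⟩
      sumFromTo 1 t (λ j → alternatingBinomial t j * (eval d a (point j) - eval d a (point 0)))
        ≡⟨ alternatingSum-differences 1≤t (eval d a ∘ point) ⟩
      sumBelow (suc t) (λ j → alternatingBinomial t j * eval d a (point j))
        ≡⟨ alternatingSum-eval ⟩
      sumBelow (suc d) (λ r → sumBelow (suc r) (term r))
        ≡⟨ sumTriangle≡rhs 1≤t t≤d ⟩
      rhs d t (differenceCoefficient d a t) s k ∎
      where
      +≡point : ∀ j → + (k ℕ.+ j ℕ.* s) ≡ point j
      +≡point j = trans (ℤ.pos-+ k (j ℕ.* s)) (trans (ℤ.+-comm (+ k) (+ (j ℕ.* s))) (cong (_+ + k) (ℤ.pos-* j s)))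

open import Data.Nat using (_≤_; _+_)
open import Data.Integer using (-[1+_]; ∣_∣; _*_; +≤+; -≤+)
import Data.Integer.Properties as ℤ
open Moments using (moment; moment-diagonal≢0; moment-subdiagonal≢0; *-≢0; +≢0)
open Expansion using (coefficient; coefficient-fromℕ; ∣coefficient∣≤; differenceCoefficient; lhs≡rhs)

maxBelow : ℕ → (ℕ → ℕ) → ℕ
maxBelow zero    f = 0
maxBelow (suc n) f = maxBelow n f ℕ.⊔ f n

≤-maxBelow : ∀ {n} (f : ℕ → ℕ) {u} → u ℕ.< n → f u ≤ maxBelow n f
≤-maxBelow {suc n} f {u} u<1+n with ℕ.m≤n⇒m<n∨m≡n u<1+n
... | inj₁ u<n  = ℕ.≤-trans (≤-maxBelow f (ℕ.≤-pred u<n)) (ℕ.m≤m⊔n (maxBelow n f) (f n))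
... | inj₂ refl = ℕ.m≤n⊔m (maxBelow n f) (f n)

momentBound : ℕ → ℕ
momentBound d = maxBelow (suc d) λ r → maxBelow (suc d) λ i → maxBelow (suc d) λ t → (r C i) ℕ.* ∣ moment (r ∸ i) t ∣

∣differenceCoefficient∣≤ : ∀ d (a : Fin (suc d) → ℤ) {t r i} → t ≤ d → r ≤ d → i ≤ d →
                           ∣ differenceCoefficient d a t r i ∣ ≤ norm d a ℕ.* momentBound d
∣differenceCoefficient∣≤ d a {t} {r} {i} t≤d r≤d i≤d = begin
  ∣ coefficient a r * + (r C i) * moment (r ∸ i) t ∣     ≡⟨ ℤ.abs-* (coefficient a r * + (r C i)) _ ⟩
  ∣ coefficient a r * + (r C i) ∣ ℕ.* ∣ moment (r ∸ i) t ∣ ≡⟨ cong (ℕ._* _) (ℤ.abs-* (coefficient a r) (+ (r C i))) ⟩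
  ∣ coefficient a r ∣ ℕ.* (r C i) ℕ.* ∣ moment (r ∸ i) t ∣   ≡⟨ ℕ.*-assoc ∣ coefficient a r ∣ (r C i) _ ⟩
  ∣ coefficient a r ∣ ℕ.* ((r C i) ℕ.* ∣ moment (r ∸ i) t ∣) ≤⟨ ℕ.*-mono-≤ coefficient≤norm momentTerm≤momentBound ⟩
  norm d a ℕ.* momentBound d                                       ∎
  where
  open ℕ.≤-Reasoning
  coefficient≤norm : ∣ coefficient a r ∣ ≤ norm d a
  coefficient≤norm = ℕ.≤-trans (∣coefficient∣≤ a r) (ℕ.m≤n+m _ d)
  momentTerm≤momentBound : (r C i) ℕ.* ∣ moment (r ∸ i) t ∣ ≤ momentBound d
  momentTerm≤momentBound = ℕ.≤-trans (≤-maxBelow _ (ℕ.s≤s t≤d))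
                             (ℕ.≤-trans (≤-maxBelow _ (ℕ.s≤s i≤d)) (≤-maxBelow _ (ℕ.s≤s r≤d)))

∣i∣≤n⇒-n≤i≤n : ∀ {i n} → ∣ i ∣ ≤ n → (- (+ n) ≤ℤ i) × (i ≤ℤ + n)
∣i∣≤n⇒-n≤i≤n {+ m}        m≤n = ℤ.neg-≤-pos , +≤+ m≤n
∣i∣≤n⇒-n≤i≤n { -[1+ m ] } m≤n = ℤ.neg-mono-≤ (+≤+ m≤n) , -≤+

differenceCoefficient[d,d∸l]≢0 : ∀ d (a : Fin (suc d) → ℤ) {t l} → + 0 < a (fromℕ d) → l ≤ d →
                              moment l t ≢ + 0 → differenceCoefficient d a t d (d ∸ l) ≢ + 0
differenceCoefficient[d,d∸l]≢0 d a {t} {l} 0<aₙ l≤d moment≢0 =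
  *-≢0 (*-≢0 aₙ≢0 (+≢0 (nCk≢0 (ℕ.m∸n≤m d l))))
       (subst (λ n → moment n t ≢ + 0) (sym (ℕ.m∸[m∸n]≡n l≤d)) moment≢0)
  where aₙ≢0 = λ aₙ≡0 → ℤ.<⇒≢ 0<aₙ (sym (trans (sym (coefficient-fromℕ d a)) aₙ≡0))

differenceCoefficient[d,d∸t]≢0 : ∀ d (a : Fin (suc d) → ℤ) {t} → + 0 < a (fromℕ d) → t ≤ d →
                                differenceCoefficient d a t d (d ∸ t) ≢ + 0
differenceCoefficient[d,d∸t]≢0 d a {t} 0<aₙ t≤d =
  differenceCoefficient[d,d∸l]≢0 d a {t} {t} 0<aₙ t≤d (moment-diagonal≢0 t)

m∸n∸1≡m∸[1+n] : ∀ m n → m ∸ n ∸ 1 ≡ m ∸ suc n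
m∸n∸1≡m∸[1+n] m n = trans (ℕ.∸-+-assoc m n 1) (cong (m ∸_) (ℕ.+-comm n 1))

differenceCoefficient[d,d∸t∸1]≢0 : ∀ d (a : Fin (suc d) → ℤ) {t} → + 0 < a (fromℕ d) → 1 ≤ t → t ≤ d ∸ 1 →
                                  differenceCoefficient d a t d (d ∸ t ∸ 1) ≢ + 0
differenceCoefficient[d,d∸t∸1]≢0 d a {t} 0<aₙ 1≤t t≤d∸1 =
  subst (λ i → differenceCoefficient d a t d i ≢ + 0) (sym (m∸n∸1≡m∸[1+n] d t))
        (differenceCoefficient[d,d∸l]≢0 d a {t} {suc t} 0<aₙ 1+t≤d (moment-subdiagonal≢0 1≤t))
  where
  1≤d : 1 ≤ d
  1≤d = ℕ.≤-trans 1≤t (ℕ.≤-trans t≤d∸1 (ℕ.m∸n≤m d 1))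
  1+t≤d : suc t ≤ d
  1+t≤d = subst (_≤ d) (ℕ.+-comm t 1) (ℕ.m≤o∸n⇒m+n≤o t 1≤d t≤d∸1)

proposition2p4 : Σ (ℕ → ℕ → ℕ) λ Q →
    (d : ℕ) → (a : Fin (suc d) → ℤ) →
    2 ≤ d → + 0 < a (fromℕ d) → ¬ OddPoly d a →
    (q : ℕ) → Q (norm d a) d ≤ q →
    (t : ℕ) → 1 ≤ t → t ≤ d →
    Σ (ℕ → ℕ → ℤ) λ h →
      ((i r : ℕ) → i ≤ d ∸ t → t + i ≤ r → r ≤ d → (- (+ q) ≤ℤ h r i) × (h r i ≤ℤ + q)) ×
      ((s k : ℕ) → lhs d a t s k ≡ rhs d t h s k) ×
      (h d (d ∸ t) ≢ + 0) ×
      (t ≤ d ∸ 1 → h d (d ∸ t ∸ 1) ≢ + 0)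
proposition2p4 = (λ ‖p‖ d → ‖p‖ ℕ.* momentBound d) , λ d a _ 0<aₙ _ q Q≤q t 1≤t t≤d →
    differenceCoefficient d a t
  , (λ i r i≤d∸t _ r≤d → ∣i∣≤n⇒-n≤i≤n
       (ℕ.≤-trans (∣differenceCoefficient∣≤ d a t≤d r≤d (ℕ.≤-trans i≤d∸t (ℕ.m∸n≤m d t))) Q≤q))
  , (λ s k → lhs≡rhs d a t s k 1≤t t≤d)
  , differenceCoefficient[d,d∸t]≢0 d a 0<aₙ t≤d
  , differenceCoefficient[d,d∸t∸1]≢0 d a 0<aₙ 1≤t
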